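{- Let $t\ge1$ and $0\le k,s\le\lfloor t/2\rfloor$, let $n=\min(k,s)$ and $\alpha_i=t-s-k+2i$ for $0\le i\le n$. Let $v$ be a $k$-vector. Then the (unordered) collections of per-quarter agreement numbers $\{\alpha^{(1)},\alpha^{(2)},\alpha^{(3)},\alpha^{(4)}\}$ realized by $s$-vectors $w$ orthogonal to $v$ are exactly those obtained from the integer solutions $(x_0,\dots,x_n)$ of the system $$x_0\alpha_0+\dots+x_n\alpha_n=2t,\qquad x_0+\dots+x_n=4,\qquad 0\le x_i\le 4,$$ where $x_i$ is the number of quarters whose agreement number equals $\alpha_i$.
   Context: Fix $t\ge1$. A $(0,1)$-vector of length $4t$ is divided into four quarters: positions $1..t$, $t+1..2t$, $2t+1..3t$, $3t+1..4t$. For $0\le k\le t$, a $k$-vector is a $(0,1)$-vector of length $4t$ with exactly $k$, $t-k$, $t-k$, $k$ ones in the four quarters respectively. Two $(0,1)$-vectors are orthogonal if their images under $0\mapsto1$, $1\mapsto-1$ are orthogonal. For a $k$-vector $v$ and an $s$-vector $w$, the agreement number $\alpha^{(j)}$ of the $j$-th quarter is the number of positions in that quarter where $v$ and $w$ agree. -}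

module Defs where

open import Data.Bool using (Bool; true; false)
open import Data.Nat using (ℕ; zero; suc; _+_; _*_; _∸_; _⊓_)
open import Data.Fin using (Fin; toℕ)
open import Data.Vec using (Vec; []; _∷_; splitAt)
open import Data.List using (List; _∷_; []; concat; tabulate; replicate)
open import Data.Nat.ListAction using (sum)
open import Data.Integer as ℤ using (ℤ; +_; -[1+_])
open import Data.Product using (_×_; _,_; proj₁; proj₂)
open import Relation.Binary.PropositionalEquality using (_≡_)

-- A (0,1)-vector of length 4t (false = 0, true = 1).
BVec : ℕ → Set
BVec t = Vec Bool (4 * t)

ones : ∀ {m} → Vec Bool m → ℕ
ones [] = 0
ones (true ∷ v) = suc (ones v)
ones (false ∷ v) = ones v

agree : ∀ {m} → Vec Bool m → Vec Bool m → ℕ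
agree [] [] = 0
agree (true ∷ v) (true ∷ w) = suc (agree v w)
agree (false ∷ v) (false ∷ w) = suc (agree v w)
agree (true ∷ v) (false ∷ w) = agree v w
agree (false ∷ v) (true ∷ w) = agree v w

sign : Bool → ℤ
sign false = + 1
sign true = -[1+ 0 ]

dotSign : ∀ {m} → Vec Bool m → Vec Bool m → ℤ
dotSign [] [] = + 0
dotSign (a ∷ v) (b ∷ w) = (sign a ℤ.* sign b) ℤ.+ dotSign v w

Orthogonal : ∀ {m} → Vec Bool m → Vec Bool m → Set
Orthogonal v w = dotSign v w ≡ + 0

-- the four quarters: positions 1..t, t+1..2t, 2t+1..3t, 3t+1..4t
-- (note 4 * t unfolds to t + (t + (t + (t + 0))))
quarter : (t : ℕ) → BVec t → Fin 4 → Vec Bool t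
quarter t v Fin.zero = proj₁ (splitAt t v)
quarter t v (Fin.suc Fin.zero) = proj₁ (splitAt t (proj₁ (proj₂ (splitAt t v))))
quarter t v (Fin.suc (Fin.suc Fin.zero)) =
  proj₁ (splitAt t (proj₁ (proj₂ (splitAt t (proj₁ (proj₂ (splitAt t v)))))))
quarter t v (Fin.suc (Fin.suc (Fin.suc Fin.zero))) =
  proj₁ (splitAt t (proj₁ (proj₂ (splitAt t (proj₁ (proj₂ (splitAt t (proj₁ (proj₂ (splitAt t v))))))))))

IsKVector : (t k : ℕ) → BVec t → Set
IsKVector t k v =
  ones (quarter t v Fin.zero) ≡ k ×
  ones (quarter t v (Fin.suc Fin.zero)) ≡ t ∸ k ×
  ones (quarter t v (Fin.suc (Fin.suc Fin.zero))) ≡ t ∸ k ×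
  ones (quarter t v (Fin.suc (Fin.suc (Fin.suc Fin.zero)))) ≡ k

-- agreement number of the j-th quarter (j = 0,1,2,3 for quarters 1..4)
agreementNumber : (t : ℕ) → BVec t → BVec t → Fin 4 → ℕ
agreementNumber t v w j = agree (quarter t v j) (quarter t w j)

-- the collection (as a list, compared up to permutation) of the four agreement numbers
agreements : (t : ℕ) → BVec t → BVec t → List ℕ
agreements t v w = tabulate (agreementNumber t v w)

-- α_i = t - s - k + 2i  (well defined in ℕ since k + s ≤ t under the hypotheses)
α : (t k s : ℕ) → Fin (suc (k ⊓ s)) → ℕ
α t k s i = (t ∸ s ∸ k) + 2 * toℕ i

IsSolution : (t k s : ℕ) → (Fin (suc (k ⊓ s)) → ℕ) → Set
IsSolution t k s x =
  sum (tabulate (λ i → x i * α t k s i)) ≡ 2 * t ×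
  sum (tabulate x) ≡ 4 ×
  (∀ i → x i Data.Nat.≤ 4)

solMultiset : (t k s : ℕ) → (Fin (suc (k ⊓ s)) → ℕ) → List ℕ
solMultiset t k s x = concat (tabulate (λ i → replicate (x i) (α t k s i)))

module Submission where

-- Write c(a,b) for the number of common ones of two (0,1)-vectors a, b of
-- length m.  Counting positions gives  agree a b + ones a + ones b = m + 2c,
-- so for an outer quarter (k and s ones) the agreement number is
-- t - s - k + 2c = α_c with 0 ≤ c ≤ min(k,s); conversely every such c is
-- attained by a suitable quarter of s ones.  Complementing both quarters
-- preserves agreement and turns an inner quarter (t-k and t-s ones) into an
-- outer one, so inner quarters behave the same way.  Finally v ⊥ w holds
-- iff v and w agree in exactly half (2t) of the positions, i.e. iff the four
-- agreement numbers sum to 2t.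

open import Defs
open import Data.Bool using (Bool; true; false; not)
open import Data.Bool.Properties using (not-involutive)
open import Data.Nat using (ℕ; zero; suc; _+_; _*_; _∸_; _≤_; _⊓_; _/_; z≤n; s≤s; s≤s⁻¹)
open import Data.Nat.Properties
open import Data.Nat.DivMod using (m/n*n≤m)
open import Data.Nat.ListAction using (sum)
open import Data.Nat.ListAction.Properties using (sum-++; sum-↭)
open import Data.Nat.Tactic.RingSolver using (solve-∀)
open import Data.Integer as ℤ using (_⊖_)
import Data.Integer.Properties as ℤP
open import Data.Fin using (Fin; zero; suc; toℕ; fromℕ<)
open import Data.Fin.Properties using (toℕ-fromℕ<; toℕ<n)
open import Data.Vec as Vec using (Vec; []; _∷_; take; drop)
open import Data.Vec.Properties using (map-∘; map-cong; map-id)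
open import Data.List using (List; []; _∷_; _++_; concat; tabulate; replicate; map; length; lookup)
open import Data.List.Properties
  using (map-++; map-replicate; length-++; length-replicate; length-tabulate; map-tabulate; tabulate-cong; tabulate-lookup)
open import Data.List.Relation.Binary.Permutation.Propositional using (_↭_; ↭-refl; ↭-reflexive; ↭-sym; ↭-trans; prep)
open import Data.List.Relation.Binary.Permutation.Propositional.Properties using (++⁺ˡ; shift; ↭-length)
open import Data.Product using (Σ-syntax; ∃; _×_; _,_; proj₁; proj₂)
open import Function using (_⇔_; mk⇔; Equivalence)
open import Relation.Binary.PropositionalEquality

private variable
  m n r N : ℕ
  A B : Set

complement : Vec Bool m → Vec Bool m
complement = Vec.map not

complement-involutive : (a : Vec Bool m) → complement (complement a) ≡ a
complement-involutive a =
  trans (sym (map-∘ not not a)) (trans (map-cong not-involutive a) (map-id a))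

ones+ones-complement : (a : Vec Bool m) → ones a + ones (complement a) ≡ m
ones+ones-complement [] = refl
ones+ones-complement (true ∷ a) = cong suc (ones+ones-complement a)
ones+ones-complement (false ∷ a) =
  trans (+-suc (ones a) _) (cong suc (ones+ones-complement a))

ones-complement : (a : Vec Bool m) → ones (complement a) ≡ m ∸ ones a
ones-complement a =
  trans (sym (m+n∸m≡n (ones a) _)) (cong (_∸ ones a) (ones+ones-complement a))

agree-complementʳ : (a b : Vec Bool m) → agree a (complement b) ≡ agree (complement a) b
agree-complementʳ [] [] = refl
agree-complementʳ (true ∷ a) (true ∷ b) = agree-complementʳ a b
agree-complementʳ (true ∷ a) (false ∷ b) = cong suc (agree-complementʳ a b)
agree-complementʳ (false ∷ a) (true ∷ b) = cong suc (agree-complementʳ a b)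
agree-complementʳ (false ∷ a) (false ∷ b) = agree-complementʳ a b

agree-complement : (a b : Vec Bool m) → agree (complement a) (complement b) ≡ agree a b
agree-complement a b =
  trans (agree-complementʳ (complement a) b) (cong (λ a′ → agree a′ b) (complement-involutive a))

disagree : Vec Bool m → Vec Bool m → ℕ
disagree a b = agree a (complement b)

agree+disagree : (a b : Vec Bool m) → agree a b + disagree a b ≡ m
agree+disagree [] [] = refl
agree+disagree (true ∷ a) (true ∷ b) = cong suc (agree+disagree a b)
agree+disagree (false ∷ a) (false ∷ b) = cong suc (agree+disagree a b)
agree+disagree (true ∷ a) (false ∷ b) = trans (+-suc (agree a b) _) (cong suc (agree+disagree a b))
agree+disagree (false ∷ a) (true ∷ b) = trans (+-suc (agree a b) _) (cong suc (agree+disagree a b))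

dotSign≡agree⊖disagree : (a b : Vec Bool m) → dotSign a b ≡ agree a b ⊖ disagree a b
dotSign≡agree⊖disagree [] [] = refl
dotSign≡agree⊖disagree (true ∷ a) (true ∷ b) =
  trans (cong (ℤ._+_ (ℤ.+ 1)) (dotSign≡agree⊖disagree a b)) (ℤP.distribʳ-⊖-+-pos 1 (agree a b) (disagree a b))
dotSign≡agree⊖disagree (false ∷ a) (false ∷ b) =
  trans (cong (ℤ._+_ (ℤ.+ 1)) (dotSign≡agree⊖disagree a b)) (ℤP.distribʳ-⊖-+-pos 1 (agree a b) (disagree a b))
dotSign≡agree⊖disagree (true ∷ a) (false ∷ b) =
  trans (cong (ℤ._+_ ℤ.-[1+ 0 ]) (dotSign≡agree⊖disagree a b)) (ℤP.distribʳ-⊖-+-neg 0 (agree a b) (disagree a b))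
dotSign≡agree⊖disagree (false ∷ a) (true ∷ b) =
  trans (cong (ℤ._+_ ℤ.-[1+ 0 ]) (dotSign≡agree⊖disagree a b)) (ℤP.distribʳ-⊖-+-neg 0 (agree a b) (disagree a b))

orthogonal⇔balanced : (a b : Vec Bool m) → Orthogonal a b ⇔ agree a b ≡ disagree a b
orthogonal⇔balanced a b = mk⇔ to from
  where
  to : Orthogonal a b → agree a b ≡ disagree a b
  to o = ℤP.+-injective (ℤP.i-j≡0⇒i≡j (ℤ.+ agree a b) (ℤ.+ disagree a b)
    (trans (ℤP.m-n≡m⊖n (agree a b) (disagree a b)) (trans (sym (dotSign≡agree⊖disagree a b)) o)))
  from : agree a b ≡ disagree a b → Orthogonal a b
  from e = trans (dotSign≡agree⊖disagree a b) (trans (cong (_⊖ disagree a b) e) (ℤP.n⊖n≡0 (disagree a b)))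

double-injective : {a b : ℕ} → a + a ≡ b + b → a ≡ b
double-injective {a} {b} e =
  *-cancelˡ-≡ a b 2 (trans (cong (a +_) (+-identityʳ a)) (trans e (cong (b +_) (sym (+-identityʳ b)))))

orthogonal⇔agree≡2t : (t : ℕ) (v w : BVec t) → Orthogonal v w ⇔ agree v w ≡ 2 * t
orthogonal⇔agree≡2t t v w = mk⇔
  (λ o → half (Equivalence.to (orthogonal⇔balanced v w) o))
  (λ e → Equivalence.from (orthogonal⇔balanced v w) (trans e (sym (other e))))
  where
  4t≡2t+2t : ∀ t → 4 * t ≡ 2 * t + 2 * t
  4t≡2t+2t = solve-∀
  total : agree v w + disagree v w ≡ 2 * t + 2 * t
  total = trans (agree+disagree v w) (4t≡2t+2t t)
  half : agree v w ≡ disagree v w → agree v w ≡ 2 * t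
  half e = double-injective (trans (cong (agree v w +_) e) total)
  other : agree v w ≡ 2 * t → disagree v w ≡ 2 * t
  other e = +-cancelˡ-≡ (2 * t) (disagree v w) (2 * t)
    (trans (cong (_+ disagree v w) (sym e)) total)

common : Vec Bool m → Vec Bool m → ℕ
common [] [] = 0
common (true ∷ a) (true ∷ b) = suc (common a b)
common (true ∷ a) (false ∷ b) = common a b
common (false ∷ a) (true ∷ b) = common a b
common (false ∷ a) (false ∷ b) = common a b

common≤onesˡ : (a b : Vec Bool m) → common a b ≤ ones a
common≤onesˡ [] [] = z≤n
common≤onesˡ (true ∷ a) (true ∷ b) = s≤s (common≤onesˡ a b)
common≤onesˡ (true ∷ a) (false ∷ b) = m≤n⇒m≤1+n (common≤onesˡ a b)
common≤onesˡ (false ∷ a) (true ∷ b) = common≤onesˡ a b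
common≤onesˡ (false ∷ a) (false ∷ b) = common≤onesˡ a b

common≤onesʳ : (a b : Vec Bool m) → common a b ≤ ones b
common≤onesʳ [] [] = z≤n
common≤onesʳ (true ∷ a) (true ∷ b) = s≤s (common≤onesʳ a b)
common≤onesʳ (true ∷ a) (false ∷ b) = common≤onesʳ a b
common≤onesʳ (false ∷ a) (true ∷ b) = m≤n⇒m≤1+n (common≤onesʳ a b)
common≤onesʳ (false ∷ a) (false ∷ b) = common≤onesʳ a b

-- Counting identity: every position contributes 1 to each side, except a
-- common one, which contributes 3 to each side.
agree+ones≡length+2common : (a b : Vec Bool m) →
  agree a b + (ones a + ones b) ≡ m + 2 * common a b
agree+ones≡length+2common [] [] = refl
agree+ones≡length+2common {suc m} (true ∷ a) (true ∷ b) = begin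
  suc (agree a b) + (suc (ones a) + suc (ones b)) ≡⟨ shuffle (agree a b) (ones a) (ones b) ⟩
  3 + (agree a b + (ones a + ones b))             ≡⟨ cong (3 +_) (agree+ones≡length+2common a b) ⟩
  3 + (m + 2 * common a b)                        ≡⟨ shuffle′ m (common a b) ⟩
  suc m + 2 * suc (common a b)                    ∎
  where
  open ≡-Reasoning
  shuffle : ∀ x p q → suc x + (suc p + suc q) ≡ 3 + (x + (p + q))
  shuffle = solve-∀
  shuffle′ : ∀ m c → 3 + (m + 2 * c) ≡ suc m + 2 * suc c
  shuffle′ = solve-∀
agree+ones≡length+2common (true ∷ a) (false ∷ b) =
  trans (+-suc (agree a b) _) (cong suc (agree+ones≡length+2common a b))
agree+ones≡length+2common (false ∷ a) (true ∷ b) =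
  trans (cong (agree a b +_) (+-suc (ones a) (ones b)))
        (trans (+-suc (agree a b) _) (cong suc (agree+ones≡length+2common a b)))
agree+ones≡length+2common (false ∷ a) (false ∷ b) = cong suc (agree+ones≡length+2common a b)

agree≡via-common : (a b : Vec Bool m) → ones a + ones b ≤ m →
  agree a b ≡ m ∸ ones b ∸ ones a + 2 * common a b
agree≡via-common {m} a b bound = begin
  agree a b
    ≡⟨ m+n∸n≡m (agree a b) (ones a + ones b) ⟨
  agree a b + (ones a + ones b) ∸ (ones a + ones b)
    ≡⟨ cong (_∸ (ones a + ones b)) (agree+ones≡length+2common a b) ⟩
  m + 2 * common a b ∸ (ones a + ones b)
    ≡⟨ +-∸-comm (2 * common a b) bound ⟩
  m ∸ (ones a + ones b) + 2 * common a b
    ≡⟨ cong (λ n → m ∸ n + 2 * common a b) (+-comm (ones a) (ones b)) ⟩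
  m ∸ (ones b + ones a) + 2 * common a b
    ≡⟨ cong (_+ 2 * common a b) (∸-+-assoc m (ones b) (ones a)) ⟨
  m ∸ ones b ∸ ones a + 2 * common a b
    ∎
  where open ≡-Reasoning

-- Any number of common ones is realisable: put c ones on ones of a and e ones on zeros of a.
vectorWithCommon : (a : Vec Bool m) (c e : ℕ) → c ≤ ones a → e ≤ ones (complement a) →
  Σ[ b ∈ Vec Bool m ] ones b ≡ c + e × common a b ≡ c
vectorWithCommon [] zero zero _ _ = [] , refl , refl
vectorWithCommon (true ∷ a) (suc c) e (s≤s c≤) e≤ =
  let b , ones-b , common-b = vectorWithCommon a c e c≤ e≤
  in true ∷ b , cong suc ones-b , cong suc common-b
vectorWithCommon (true ∷ a) zero e _ e≤ =
  let b , ones-b , common-b = vectorWithCommon a zero e z≤n e≤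
  in false ∷ b , ones-b , common-b
vectorWithCommon (false ∷ a) c (suc e) c≤ (s≤s e≤) =
  let b , ones-b , common-b = vectorWithCommon a c e c≤ e≤
  in true ∷ b , trans (cong suc ones-b) (sym (+-suc c e)) , common-b
vectorWithCommon (false ∷ a) c zero c≤ _ =
  let b , ones-b , common-b = vectorWithCommon a c zero c≤ z≤n
  in false ∷ b , ones-b , common-b

agree-take-drop : ∀ n (v w : Vec Bool (n + r)) →
  agree v w ≡ agree (take n v) (take n w) + agree (drop n v) (drop n w)
agree-take-drop zero v w = refl
agree-take-drop (suc n) (true ∷ v) (true ∷ w) = cong suc (agree-take-drop n v w)
agree-take-drop (suc n) (true ∷ v) (false ∷ w) = agree-take-drop n v w
agree-take-drop (suc n) (false ∷ v) (true ∷ w) = agree-take-drop n v w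
agree-take-drop (suc n) (false ∷ v) (false ∷ w) = cong suc (agree-take-drop n v w)

agree-empty : (v w : Vec Bool 0) → agree v w ≡ 0
agree-empty [] [] = refl

agree≡sum-agreements : (t : ℕ) (v w : BVec t) → agree v w ≡ sum (agreements t v w)
agree≡sum-agreements t v w =
  trans (agree-take-drop t v w) (cong (agreementNumber t v w zero +_)
  (trans (agree-take-drop t _ _) (cong (agreementNumber t v w (suc zero) +_)
  (trans (agree-take-drop t _ _) (cong (agreementNumber t v w (suc (suc zero)) +_)
  (trans (agree-take-drop t _ _) (cong (agreementNumber t v w (suc (suc (suc zero))) +_)
  (agree-empty (drop t (drop t (drop t (drop t v)))) (drop t (drop t (drop t (drop t w))))))))))))

take-++ : (xs : Vec A n) (ys : Vec A r) → take n (xs Vec.++ ys) ≡ xs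
take-++ [] ys = refl
take-++ (x ∷ xs) ys = cong (x ∷_) (take-++ xs ys)

drop-++ : (xs : Vec A n) (ys : Vec A r) → drop n (xs Vec.++ ys) ≡ ys
drop-++ [] ys = refl
drop-++ (x ∷ xs) ys = drop-++ xs ys

assemble : (t : ℕ) → (Fin 4 → Vec Bool t) → BVec t
assemble t b = b zero Vec.++ (b (suc zero) Vec.++ (b (suc (suc zero)) Vec.++ (b (suc (suc (suc zero))) Vec.++ [])))

quarter-assemble : (t : ℕ) (b : Fin 4 → Vec Bool t) (j : Fin 4) → quarter t (assemble t b) j ≡ b j
quarter-assemble t b zero = take-++ (b zero) _
quarter-assemble t b (suc zero) =
  trans (cong (take t) (drop-++ (b zero) _)) (take-++ (b (suc zero)) _)
quarter-assemble t b (suc (suc zero)) =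
  trans (cong (λ u → take t (drop t u)) (drop-++ (b zero) _))
  (trans (cong (take t) (drop-++ (b (suc zero)) _)) (take-++ (b (suc (suc zero))) _))
quarter-assemble t b (suc (suc (suc zero))) =
  trans (cong (λ u → take t (drop t (drop t u))) (drop-++ (b zero) _))
  (trans (cong (λ u → take t (drop t u)) (drop-++ (b (suc zero)) _))
  (trans (cong (take t) (drop-++ (b (suc (suc zero))) _)) (take-++ (b (suc (suc (suc zero)))) _)))

-- The list with x i copies of f i, in order of i; solMultiset t k s x is
-- expand x (α t k s).
expand : (Fin N → ℕ) → (Fin N → A) → List A
expand x f = concat (tabulate (λ i → replicate (x i) (f i)))

δ : Fin N → Fin N → ℕ
δ zero zero = 1
δ zero (suc i) = 0
δ (suc j) zero = 0
δ (suc j) (suc i) = δ j i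

multiplicity : List (Fin N) → Fin N → ℕ
multiplicity [] i = 0
multiplicity (j ∷ js) i = δ j i + multiplicity js i

expand-zero : (f : Fin N → A) → expand (λ _ → 0) f ≡ []
expand-zero {zero} f = refl
expand-zero {suc N} f = expand-zero (λ i → f (suc i))

expand-δ : (j : Fin N) (y : Fin N → ℕ) (f : Fin N → A) →
  expand (λ i → δ j i + y i) f ↭ f j ∷ expand y f
expand-δ zero y f = ↭-refl
expand-δ (suc j) y f =
  ↭-trans (++⁺ˡ (replicate (y zero) (f zero)) (expand-δ j (λ i → y (suc i)) (λ i → f (suc i))))
          (shift (f (suc j)) (replicate (y zero) (f zero)) _)

map↭expand-multiplicity : (f : Fin N → A) (js : List (Fin N)) → map f js ↭ expand (multiplicity js) f
map↭expand-multiplicity f [] = ↭-reflexive (sym (expand-zero f))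
map↭expand-multiplicity f (j ∷ js) =
  ↭-trans (prep (f j) (map↭expand-multiplicity f js)) (↭-sym (expand-δ j (multiplicity js) f))

map-expand : (g : A → B) (x : Fin N → ℕ) (f : Fin N → A) → map g (expand x f) ≡ expand x (λ i → g (f i))
map-expand {N = zero} g x f = refl
map-expand {N = suc N} g x f =
  trans (map-++ g (replicate (x zero) (f zero)) _)
        (cong₂ _++_ (map-replicate g (x zero) (f zero)) (map-expand g (λ i → x (suc i)) (λ i → f (suc i))))

length-expand : (x : Fin N → ℕ) (f : Fin N → A) → length (expand x f) ≡ sum (tabulate x)
length-expand {zero} x f = refl
length-expand {suc N} x f =
  trans (length-++ (replicate (x zero) (f zero)))
        (cong₂ _+_ (length-replicate (x zero)) (length-expand (λ i → x (suc i)) (λ i → f (suc i))))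

sum-replicate : (n a : ℕ) → sum (replicate n a) ≡ n * a
sum-replicate zero a = refl
sum-replicate (suc n) a = cong (a +_) (sum-replicate n a)

sum-expand : (x f : Fin N → ℕ) → sum (expand x f) ≡ sum (tabulate (λ i → x i * f i))
sum-expand {zero} x f = refl
sum-expand {suc N} x f =
  trans (sum-++ (replicate (x zero) (f zero)) _)
        (cong₂ _+_ (sum-replicate (x zero) (f zero)) (sum-expand (λ i → x (suc i)) (λ i → f (suc i))))

entry≤sum : (x : Fin N → ℕ) (i : Fin N) → x i ≤ sum (tabulate x)
entry≤sum x zero = m≤m+n (x zero) _
entry≤sum x (suc i) = ≤-trans (entry≤sum (λ i → x (suc i)) i) (m≤n+m _ (x zero))

asTabulate : (xs : List A) {n : ℕ} → length xs ≡ n → Σ[ σ ∈ (Fin n → A) ] tabulate σ ≡ xs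
asTabulate xs refl = lookup xs , tabulate-lookup xs

weight : ℕ → ℕ → Fin 4 → ℕ
weight t k zero = k
weight t k (suc zero) = t ∸ k
weight t k (suc (suc zero)) = t ∸ k
weight t k (suc (suc (suc zero))) = k

kVector⇒weights : {t k : ℕ} {v : BVec t} → IsKVector t k v → (j : Fin 4) → ones (quarter t v j) ≡ weight t k j
kVector⇒weights (h₀ , h₁ , h₂ , h₃) zero = h₀
kVector⇒weights (h₀ , h₁ , h₂ , h₃) (suc zero) = h₁
kVector⇒weights (h₀ , h₁ , h₂ , h₃) (suc (suc zero)) = h₂
kVector⇒weights (h₀ , h₁ , h₂ , h₃) (suc (suc (suc zero))) = h₃

weights⇒kVector : {t k : ℕ} {v : BVec t} → ((j : Fin 4) → ones (quarter t v j) ≡ weight t k j) → IsKVector t k v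
weights⇒kVector h = h zero , h (suc zero) , h (suc (suc zero)) , h (suc (suc (suc zero)))

module SingleQuarter (t k s : ℕ) (k+s≤t : k + s ≤ t) where

  index-bounds : (i : Fin (suc (k ⊓ s))) → toℕ i ≤ k × toℕ i ≤ s
  index-bounds i = m≤n⊓o⇒m≤n k s i≤k⊓s , m≤n⊓o⇒m≤o k s i≤k⊓s
    where i≤k⊓s = s≤s⁻¹ (toℕ<n i)

  agree-outer : (a b : Vec Bool t) → ones a ≡ k → ones b ≡ s →
    agree a b ≡ t ∸ s ∸ k + 2 * common a b
  agree-outer a b ha hb =
    trans (agree≡via-common a b (subst₂ (λ p q → p + q ≤ t) (sym ha) (sym hb) k+s≤t))
          (cong₂ (λ p q → t ∸ q ∸ p + 2 * common a b) ha hb)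

  outerIndex : (a b : Vec Bool t) → ones a ≡ k → ones b ≡ s →
    Σ[ i ∈ Fin (suc (k ⊓ s)) ] agree a b ≡ α t k s i
  outerIndex a b ha hb =
    fromℕ< c<1+k⊓s ,
    trans (agree-outer a b ha hb) (cong (λ c → t ∸ s ∸ k + 2 * c) (sym (toℕ-fromℕ< c<1+k⊓s)))
    where
    c<1+k⊓s : suc (common a b) ≤ suc (k ⊓ s)
    c<1+k⊓s = s≤s (⊓-glb (subst (common a b ≤_) ha (common≤onesˡ a b))
                         (subst (common a b ≤_) hb (common≤onesʳ a b)))

  -- Every α_i arises in an outer quarter: take i common ones and s - i further
  -- ones among the t - k zeros of a.
  outerRealize : (a : Vec Bool t) → ones a ≡ k → (i : Fin (suc (k ⊓ s))) →
    Σ[ b ∈ Vec Bool t ] ones b ≡ s × agree a b ≡ α t k s i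
  outerRealize a ha i =
    b , ones-b , trans (agree-outer a b ha ones-b) (cong (λ c → t ∸ s ∸ k + 2 * c) common-b)
    where
    c : ℕ
    c = toℕ i
    c≤k : c ≤ k
    c≤k = proj₁ (index-bounds i)
    c≤s : c ≤ s
    c≤s = proj₂ (index-bounds i)
    s≤zeros : s ≤ ones (complement a)
    s≤zeros = subst (s ≤_) (sym (trans (ones-complement a) (cong (t ∸_) ha)))
                    (m+n≤o⇒m≤o∸n s (subst (_≤ t) (+-comm k s) k+s≤t))
    realized : Σ[ b ∈ Vec Bool t ] ones b ≡ c + (s ∸ c) × common a b ≡ c
    realized = vectorWithCommon a c (s ∸ c) (subst (c ≤_) (sym ha) c≤k) (≤-trans (m∸n≤m s c) s≤zeros)
    b : Vec Bool t
    b = proj₁ realized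
    ones-b : ones b ≡ s
    ones-b = trans (proj₁ (proj₂ realized)) (m+[n∸m]≡n c≤s)
    common-b : common a b ≡ c
    common-b = proj₂ (proj₂ realized)

  complement-inner : (a : Vec Bool t) {n : ℕ} → n ≤ t → ones a ≡ t ∸ n → ones (complement a) ≡ n
  complement-inner a n≤t h = trans (ones-complement a) (trans (cong (t ∸_) h) (m∸[m∸n]≡n n≤t))

  k≤t : k ≤ t
  k≤t = m+n≤o⇒m≤o k k+s≤t

  s≤t : s ≤ t
  s≤t = m+n≤o⇒n≤o k k+s≤t

  innerIndex : (a b : Vec Bool t) → ones a ≡ t ∸ k → ones b ≡ t ∸ s →
    Σ[ i ∈ Fin (suc (k ⊓ s)) ] agree a b ≡ α t k s i
  innerIndex a b ha hb =
    let i , agree-i = outerIndex (complement a) (complement b) (complement-inner a k≤t ha) (complement-inner b s≤t hb)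
    in i , trans (sym (agree-complement a b)) agree-i

  innerRealize : (a : Vec Bool t) → ones a ≡ t ∸ k → (i : Fin (suc (k ⊓ s))) →
    Σ[ b ∈ Vec Bool t ] ones b ≡ t ∸ s × agree a b ≡ α t k s i
  innerRealize a ha i =
    let b , ones-b , agree-b = outerRealize (complement a) (complement-inner a k≤t ha) i
    in complement b , trans (ones-complement b) (cong (t ∸_) ones-b) , trans (agree-complementʳ a b) agree-b

  quarterIndex : (j : Fin 4) (a b : Vec Bool t) → ones a ≡ weight t k j → ones b ≡ weight t s j →
    Σ[ i ∈ Fin (suc (k ⊓ s)) ] agree a b ≡ α t k s i
  quarterIndex zero = outerIndex
  quarterIndex (suc zero) = innerIndex
  quarterIndex (suc (suc zero)) = innerIndex
  quarterIndex (suc (suc (suc zero))) = outerIndex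

  quarterRealize : (j : Fin 4) (a : Vec Bool t) → ones a ≡ weight t k j → (i : Fin (suc (k ⊓ s))) →
    Σ[ b ∈ Vec Bool t ] ones b ≡ weight t s j × agree a b ≡ α t k s i
  quarterRealize zero = outerRealize
  quarterRealize (suc zero) = innerRealize
  quarterRealize (suc (suc zero)) = innerRealize
  quarterRealize (suc (suc (suc zero))) = outerRealize

module _ (t k s : ℕ) {v w : BVec t} {x : Fin (suc (k ⊓ s)) → ℕ}
         (agreements↭x : agreements t v w ↭ solMultiset t k s x) where

  -- There are four quarters, so the multiplicities add up to 4.
  multiplicities-sum : sum (tabulate x) ≡ 4
  multiplicities-sum =
    trans (sym (length-expand x (α t k s))) (trans (sym (↭-length agreements↭x)) (length-tabulate (agreementNumber t v w)))

  weighted-sum≡agree : sum (tabulate (λ i → x i * α t k s i)) ≡ agree v w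
  weighted-sum≡agree =
    trans (sym (sum-expand x (α t k s))) (trans (sym (sum-↭ agreements↭x)) (sym (agree≡sum-agreements t v w)))

  orthogonal⇒solution : Orthogonal v w → IsSolution t k s x
  orthogonal⇒solution o =
    trans weighted-sum≡agree (Equivalence.to (orthogonal⇔agree≡2t t v w) o) ,
    multiplicities-sum ,
    λ i → subst (x i ≤_) multiplicities-sum (entry≤sum x i)

  solution⇒orthogonal : IsSolution t k s x → Orthogonal v w
  solution⇒orthogonal (weighted , _) =
    Equivalence.from (orthogonal⇔agree≡2t t v w) (trans (sym weighted-sum≡agree) weighted)

-- k + s ≤ t, which makes every α_i a genuine value t - s - k + 2i.
k+s≤t : (t k s : ℕ) → k ≤ t / 2 → s ≤ t / 2 → k + s ≤ t
k+s≤t t k s k≤ s≤ = ≤-trans (+-mono-≤ k≤ s≤) (subst (_≤ t) (double (t / 2)) (m/n*n≤m t 2))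
  where
  double : ∀ n → n * 2 ≡ n + n
  double = solve-∀

module _ (t k s : ℕ) (k+s≤t : k + s ≤ t) (v : BVec t) (v-kVector : IsKVector t k v) where
  open SingleQuarter t k s k+s≤t

  -- Each s-vector orthogonal to v yields a solution: count how often each α_i occurs.
  countAgreements : (w : BVec t) → IsKVector t s w → Orthogonal v w →
    ∃ λ (x : Fin (suc (k ⊓ s)) → ℕ) → IsSolution t k s x × agreements t v w ↭ solMultiset t k s x
  countAgreements w w-kVector o = x , orthogonal⇒solution t k s agreements↭x o , agreements↭x
    where
    indexed : (j : Fin 4) → Σ[ i ∈ Fin (suc (k ⊓ s)) ] agreementNumber t v w j ≡ α t k s i
    indexed j = quarterIndex j (quarter t v j) (quarter t w j)
                  (kVector⇒weights v-kVector j) (kVector⇒weights w-kVector j)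
    index : Fin 4 → Fin (suc (k ⊓ s))
    index j = proj₁ (indexed j)
    x : Fin (suc (k ⊓ s)) → ℕ
    x = multiplicity (tabulate index)
    agreements↭x : agreements t v w ↭ solMultiset t k s x
    agreements↭x =
      ↭-trans (↭-reflexive (trans (tabulate-cong (λ j → proj₂ (indexed j))) (sym (map-tabulate index (α t k s)))))
              (map↭expand-multiplicity (α t k s) (tabulate index))

  -- Each solution is realized: list its four indices, one per quarter, and
  -- realize each quarter separately.
  realizeSolution : (x : Fin (suc (k ⊓ s)) → ℕ) → IsSolution t k s x →
    ∃ λ (w : BVec t) → IsKVector t s w × Orthogonal v w × agreements t v w ↭ solMultiset t k s x
  realizeSolution x solution@(_ , four , _) = w , w-kVector , solution⇒orthogonal t k s agreements↭x solution , agreements↭x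
    where
    indices : List (Fin (suc (k ⊓ s)))
    indices = expand x (λ i → i)
    tabulation : Σ[ σ ∈ (Fin 4 → Fin (suc (k ⊓ s))) ] tabulate σ ≡ indices
    tabulation = asTabulate indices (trans (length-expand x (λ i → i)) four)
    σ : Fin 4 → Fin (suc (k ⊓ s))
    σ = proj₁ tabulation
    realized : (j : Fin 4) →
      Σ[ b ∈ Vec Bool t ] ones b ≡ weight t s j × agree (quarter t v j) b ≡ α t k s (σ j)
    realized j = quarterRealize j (quarter t v j) (kVector⇒weights v-kVector j) (σ j)
    b : Fin 4 → Vec Bool t
    b j = proj₁ (realized j)
    w : BVec t
    w = assemble t b
    w-kVector : IsKVector t s w
    w-kVector = weights⇒kVector (λ j → trans (cong ones (quarter-assemble t b j)) (proj₁ (proj₂ (realized j))))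
    agreements↭x : agreements t v w ↭ solMultiset t k s x
    agreements↭x = ↭-reflexive (begin
      agreements t v w                 ≡⟨ tabulate-cong (λ j → trans (cong (agree (quarter t v j)) (quarter-assemble t b j))
                                                                       (proj₂ (proj₂ (realized j)))) ⟩
      tabulate (λ j → α t k s (σ j))   ≡⟨ map-tabulate σ (α t k s) ⟨
      map (α t k s) (tabulate σ)       ≡⟨ cong (map (α t k s)) (proj₂ tabulation) ⟩
      map (α t k s) indices            ≡⟨ map-expand (α t k s) x (λ i → i) ⟩
      solMultiset t k s x              ∎)
      where open ≡-Reasoning

-- The two directions, for k + s ≤ t.
proposition2 : (t k s : ℕ) → 1 ≤ t → k ≤ t / 2 → s ≤ t / 2 →
    (v : BVec t) → IsKVector t k v →
    ((w : BVec t) → IsKVector t s w → Orthogonal v w →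
       ∃ λ (x : Fin (suc (k ⊓ s)) → ℕ) →
         IsSolution t k s x × agreements t v w ↭ solMultiset t k s x)
    ×
    ((x : Fin (suc (k ⊓ s)) → ℕ) → IsSolution t k s x →
       ∃ λ (w : BVec t) →
         IsKVector t s w × Orthogonal v w × agreements t v w ↭ solMultiset t k s x)
proposition2 t k s _ k≤ s≤ v v-kVector =
  countAgreements t k s (k+s≤t t k s k≤ s≤) v v-kVector ,
  realizeSolution t k s (k+s≤t t k s k≤ s≤) v v-kVector
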